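{- For every workflow net $N$ with task durations such that $(N,M_I)$ is 1-safe, $\mathrm{RT}(N)\le\mathrm{CT}(N)$.
   Context: A workflow net $N=(P,T,F,I,O,\tau)$: a Petri net with input/output places $I,O$, $\bullet I=\emptyset=O\bullet$, every node on a path from $I$ to $O$, and durations $\tau\colon P\to\mathbb{N}$; $M_I,M_O$ put one token on each place of $I$, resp. $O$. Let $D=\{p\in P\mid\tau(p)>0\}$; for a marking $M$, $\mathrm{conc}(M)=\sum_{p\in D}M(p)$, and $\mathrm{CT}(N)=\max\{\mathrm{conc}(M)\mid M\text{ reachable from }M_I\}$. Processes of $(N,M_I)$ are $(P,T)$-labeled acyclic nets $(P',T',F',\lambda,\mu)$ built inductively: start with one place labeled $p$ per place marked at $M_I$; given a process and a set of causally maximal places $P''$ with pairwise distinct labels and $\lambda(P'')=\bullet t$, add a new transition labeled $t$ with preset $P''$ and a fresh place labeled $p$ for each $p\in t\bullet$ as postset. The final marking is the one reached by firing the labels of the transitions along any linearization of the causal order $\preceq$; a run is a process with final marking $M_O$. A run is executable within time $t$ with $k$ resources if there is $f\colon P'\to\mathbb{N}$ with: $p_1'\prec p_2'\Rightarrow f(p_1')+\tau(\lambda(p_1'))\le f(p_2')$; $f(p')+\tau(\lambda(p'))\le t$ for all $p'$; and for each $0\le u<t$ at most $k$ places with $f(p')\le u<f(p')+\tau(\lambda(p'))$. $t_{\min}(\Pi)$ is the least $t$ for which such $f$ satisfying the first two conditions exists. $\mathrm{RT}(\Pi)$ is the least $k$ with $\Pi$ executable within time $t_{\min}(\Pi)$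 with $k$ resources, and $\mathrm{RT}(N)$ is the maximum of $\mathrm{RT}(\Pi)$ over all runs $\Pi$ of $(N,M_I)$. -}

module Defs where

open import Data.Nat using (ℕ; zero; suc; _+_; _≤_; _<_)
open import Data.Fin using (Fin)
open import Data.Bool using (Bool; true; false; if_then_else_)
open import Data.Maybe using (Maybe; just; nothing)
open import Data.List using (List; []; _∷_; _∷ʳ_; map; allFin; foldl; length)
open import Data.Nat.ListAction using (sum)
open import Data.List.Membership.Propositional using (_∈_)
open import Data.List.Relation.Unary.All using (All)
open import Data.List.Relation.Unary.Unique.Propositional using (Unique)
open import Data.Product using (Σ; ∃; _×_; _,_; proj₁; proj₂)
open import Data.Sum using (_⊎_)
open import Data.Empty using (⊥)
open import Relation.Nullary using (¬_)
open import Relation.Binary.PropositionalEquality using (_≡_)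
open import Relation.Binary.Construct.Closure.ReflexiveTransitive using (Star)
open import Relation.Binary.Construct.Closure.Transitive using (TransClosure)
open import Function.Bundles using (_⇔_)

-- Petri nets with durations.  Places are Fin np, transitions Fin nt.
-- The flow relation F is given by  pre t p  (p F t)  and  post t p  (t F p).
-- I and O are sets of places, τ the durations.

record Net : Set where
  field
    np   : ℕ
    nt   : ℕ
    pre  : Fin nt → Fin np → Bool
    post : Fin nt → Fin np → Bool
    I    : Fin np → Bool
    O    : Fin np → Bool
    τ    : Fin np → ℕ

Marking : ℕ → Set
Marking np = Fin np → ℕ

-- condition identifiers of processes: an initial place (one per place of I)
-- or the place produced for p ∈ t• by the j-th added transition
data CondId (np : ℕ) : Set where
  ini : Fin np → CondId np
  out : ℕ → Fin np → CondId np

lab : ∀ {np} → CondId np → Fin np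
lab (ini p)   = p
lab (out _ p) = p

module _ (N : Net) where
  open Net N

  Node : Set
  Node = Fin np ⊎ Fin nt

  data Flow : Node → Node → Set where
    pt : ∀ p t → pre t p ≡ true  → Flow (Data.Sum.inj₁ p) (Data.Sum.inj₂ t)
    tp : ∀ t p → post t p ≡ true → Flow (Data.Sum.inj₂ t) (Data.Sum.inj₁ p)

  IsWorkflowNet : Set
  IsWorkflowNet =
    (∀ t p → I p ≡ true → post t p ≡ false) ×
    (∀ t p → O p ≡ true → pre t p ≡ false) ×
    (∀ (x : Node) →
       (∃ λ i → I i ≡ true × Star Flow (Data.Sum.inj₁ i) x) ×
       (∃ λ o → O o ≡ true × Star Flow x (Data.Sum.inj₁ o)))

  indicator : Bool → ℕ
  indicator true  = 1
  indicator false = 0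

  M-I : Marking np
  M-I p = indicator (I p)

  M-O : Marking np
  M-O p = indicator (O p)

  Enabled : Marking np → Fin nt → Set
  Enabled M t = ∀ p → pre t p ≡ true → 1 ≤ M p

  -- marking after firing t (meaningful when t is enabled)
  fire : Marking np → Fin nt → Marking np
  fire M t p = (M p Data.Nat.∸ indicator (pre t p)) + indicator (post t p)

  data Reachable : Marking np → Set where
    init : Reachable M-I
    step : ∀ {M} t → Reachable M → Enabled M t → Reachable (fire M t)

  OneSafe : Set
  OneSafe = ∀ M → Reachable M → ∀ p → M p ≤ 1

  -- conc(M) = Σ_{p ∈ D} M(p),  D = { p | τ(p) > 0 }
  weight : ℕ → ℕ → ℕ
  weight zero    m = 0
  weight (suc _) m = m

  conc : Marking np → ℕ
  conc M = sum (map (λ p → weight (τ p) (M p)) (allFin np))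

  IsCT : ℕ → Set
  IsCT c = (∃ λ M → Reachable M × conc M ≡ c) × (∀ M → Reachable M → conc M ≤ c)

  -- A process is recorded by the list of transitions added in
  -- the inductive construction, in order: the j-th entry is (t , P'') with
  -- t the label of the new transition and P'' its preset.  The fresh places
  -- of the j-th transition are  out j p  for p ∈ t•, the initial places are
  -- ini p for p ∈ I.

  Ev : Set
  Ev = Fin nt × List (CondId np)

  evAt : List Ev → ℕ → Maybe Ev
  evAt []       _       = nothing
  evAt (e ∷ es) zero    = just e
  evAt (e ∷ es) (suc j) = evAt es j

  IsCond : List Ev → CondId np → Set
  IsCond es (ini p)   = I p ≡ true
  IsCond es (out j p) = ∃ λ e → evAt es j ≡ just e × post (proj₁ e) p ≡ true

  Consumed : List Ev → CondId np → Set
  Consumed es c = ∃ λ j → ∃ λ e → evAt es j ≡ just e × c ∈ proj₂ e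

  data IsProcess : List Ev → Set where
    start  : IsProcess []
    extend : ∀ {es} → IsProcess es → (t : Fin nt) → (P'' : List (CondId np)) →
             All (IsCond es) P'' →
             All (λ c → ¬ Consumed es c) P'' →           -- causally maximal
             Unique (map lab P'') →
             (∀ p → (pre t p ≡ true) ⇔ (p ∈ map lab P'')) →
             IsProcess (es ∷ʳ (t , P''))

  finalMarking : List Ev → Marking np
  finalMarking es = foldl (λ M e → fire M (proj₁ e)) M-I es

  IsRun : List Ev → Set
  IsRun es = IsProcess es × (∀ p → finalMarking es p ≡ M-O p)

  Step : List Ev → CondId np → CondId np → Set
  Step es c (ini _)    = ⊥
  Step es c (out j p)  = ∃ λ e → evAt es j ≡ just e × post (proj₁ e) p ≡ true × c ∈ proj₂ e

  _≺[_]_ : CondId np → List Ev → CondId np → Set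
  c ≺[ es ] c' = TransClosure (Step es) c c'

  dur : CondId np → ℕ
  dur c = τ (lab c)

  Schedule : List Ev → ℕ → (CondId np → ℕ) → Set
  Schedule es t f =
    (∀ c₁ c₂ → IsCond es c₁ → IsCond es c₂ → c₁ ≺[ es ] c₂ → f c₁ + dur c₁ ≤ f c₂) ×
    (∀ c → IsCond es c → f c + dur c ≤ t)

  Active : (CondId np → ℕ) → ℕ → CondId np → Set
  Active f u c = f c ≤ u × u < f c + dur c

  ResourceBound : List Ev → ℕ → (CondId np → ℕ) → ℕ → Set
  ResourceBound es t f k =
    ∀ u → u < t → ∀ (L : List (CondId np)) → Unique L → All (IsCond es) L →
      All (Active f u) L → length L ≤ k

  ExecutableWith : List Ev → ℕ → ℕ → Set
  ExecutableWith es t k = ∃ λ f → Schedule es t f × ResourceBound es t f k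

  IsTmin : List Ev → ℕ → Set
  IsTmin es t = (∃ λ f → Schedule es t f) × (∀ t' f → Schedule es t' f → t ≤ t')

  IsRT : List Ev → ℕ → Set
  IsRT es k = ∃ λ t → IsTmin es t × ExecutableWith es t k ×
                      (∀ k' → ExecutableWith es t k' → k ≤ k')

module Submission where

-- Fix a run Π and a schedule f attaining t_min(Π); it suffices to show that
-- f needs at most c = CT(N) resources.  Places active at one instant u are
-- pairwise causally unrelated (a predecessor ends before its successor
-- starts) and have positive duration.  The core is the classical fact that
-- cuts of processes are markings: every antichain L of a process is covered
-- by a reachable marking M, i.e. #{c ∈ L | λ(c) = p} ≤ M(p) for all p.  It is
-- proved along the construction of the process: if the last transition t
-- has an output place in L, the older places of L together with the preset
-- of t form an antichain of the smaller process, and firing t in the marking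
-- covering them covers L.  Then |L| ≤ conc(M) ≤ c.

open import Defs
open import Data.Nat using (ℕ; _≤_)
open import Data.List using (List)

open import Data.Nat using (zero; suc; _+_; _∸_; _<_; z≤n; s≤s; _≟_; _≤?_)
open import Data.Nat.Properties
open import Data.Nat.ListAction using (sum)
open import Data.Fin using (Fin) renaming (zero to fzero; suc to fsuc)
open import Data.Bool using (true; false)
open import Data.Maybe using (just)
open import Data.Maybe.Properties using (just-injective)
open import Data.List using ([]; _∷_; _∷ʳ_; _++_; map; filter; tabulate; length)
open import Data.List.Properties using (map-tabulate)
open import Data.List.Membership.Propositional using (_∈_; find)
open import Data.List.Membership.Propositional.Properties
  using (∈-filter⁻; ∈-map⁻; ∈-++⁻)
open import Data.List.Relation.Unary.Any using (here; there; any?)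
open import Data.List.Relation.Unary.All as All using (All; []; _∷_)
open import Data.List.Relation.Unary.All.Properties using (++⁺; ¬Any⇒All¬)
open import Data.List.Relation.Unary.AllPairs using (_∷_)
open import Data.List.Relation.Unary.Unique.Propositional using (Unique)
import Data.List.Relation.Unary.Unique.Propositional.Properties as Unique
open import Data.Product using (∃; _×_; _,_; proj₁; proj₂)
open import Data.Sum using (_⊎_; inj₁; inj₂)
open import Data.Empty using (⊥; ⊥-elim)
open import Function using (_∘_)
open import Function.Bundles using (Equivalence; _⇔_)
open import Relation.Nullary using (¬_; yes; no; ¬?)
open import Relation.Unary using (Decidable)
open import Relation.Binary.PropositionalEquality
open import Relation.Binary.Construct.Closure.Transitive
  using ([_]; _∷_) renaming (_∷ʳ_ to _⁺∷ʳ_)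
open import Algebra.Properties.CommutativeSemigroup +-commutativeSemigroup
  using (x∙yz≈y∙xz)
open import Algebra.Properties.CommutativeMonoid.Sum +-0-commutativeMonoid
  using (∑-distrib-+; sum-cong-≗; sum-replicate-zero) renaming (sum to ∑)

δ : ∀ {n} → Fin n → Fin n → ℕ
δ fzero    fzero    = 1
δ fzero    (fsuc _) = 0
δ (fsuc _) fzero    = 0
δ (fsuc q) (fsuc p) = δ q p

δ-refl : ∀ {n} (q : Fin n) → δ q q ≡ 1
δ-refl fzero    = refl
δ-refl (fsuc q) = δ-refl q

δ≤1 : ∀ {n} (q p : Fin n) → δ q p ≤ 1
δ≤1 fzero    fzero    = s≤s z≤n
δ≤1 fzero    (fsuc _) = z≤n
δ≤1 (fsuc _) fzero    = z≤n
δ≤1 (fsuc q) (fsuc p) = δ≤1 q p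

δ-support : ∀ {n} (q p : Fin n) → 1 ≤ δ q p → q ≡ p
δ-support fzero    fzero    _   = refl
δ-support fzero    (fsuc _) ()
δ-support (fsuc _) fzero    ()
δ-support (fsuc q) (fsuc p) δ≥1 = cong fsuc (δ-support q p δ≥1)

δ-off : ∀ {n} {q p : Fin n} → q ≢ p → δ q p ≡ 0
δ-off {q = fzero}  {fzero}  q≢p = ⊥-elim (q≢p refl)
δ-off {q = fzero}  {fsuc _} _   = refl
δ-off {q = fsuc _} {fzero}  _   = refl
δ-off {q = fsuc _} {fsuc _} q≢p = δ-off (q≢p ∘ cong fsuc)

∑-mono : ∀ {n} (F G : Fin n → ℕ) → (∀ i → F i ≤ G i) → ∑ F ≤ ∑ G
∑-mono {zero}  _ _ _   = z≤n
∑-mono {suc n} F G F≤G = +-mono-≤ (F≤G fzero) (∑-mono (F ∘ fsuc) (G ∘ fsuc) (F≤G ∘ fsuc))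

∑-zero : ∀ {n} (F : Fin n → ℕ) → (∀ i → F i ≡ 0) → ∑ F ≡ 0
∑-zero {n} F F≡0 = trans (sum-cong-≗ F≡0) (sum-replicate-zero n)

∑-δ : ∀ {n} (h : Fin n → ℕ → ℕ) → (∀ i → h i 0 ≡ 0) → ∀ q →
      ∑ (λ i → h i (δ q i)) ≡ h q 1
∑-δ {suc n} h h0 fzero    =
  trans (cong (h fzero 1 +_) (∑-zero _ (h0 ∘ fsuc))) (+-identityʳ _)
∑-δ {suc n} h h0 (fsuc q) =
  trans (cong (_+ ∑ (λ i → h (fsuc i) (δ q i))) (h0 fzero))
        (∑-δ (h ∘ fsuc) (h0 ∘ fsuc) q)

sum-tabulate : ∀ {n} (F : Fin n → ℕ) → sum (tabulate F) ≡ ∑ F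
sum-tabulate {zero}  F = refl
sum-tabulate {suc n} F = cong (F fzero +_) (sum-tabulate (F ∘ fsuc))

module LabelCount {A : Set} {n : ℕ} (label : A → Fin n) where

  count : List A → Fin n → ℕ
  count []      p = 0
  count (a ∷ L) p = δ (label a) p + count L p

  LabelInjective : List A → Set
  LabelInjective L = ∀ {a b} → a ∈ L → b ∈ L → label a ≡ label b → a ≡ b

  count-∈ : ∀ {a L} → a ∈ L → 1 ≤ count L (label a)
  count-∈ {a} (here refl) rewrite δ-refl (label a) = s≤s z≤n
  count-∈ {a} {b ∷ L} (there a∈L) = ≤-trans (count-∈ a∈L) (m≤n+m _ (δ (label b) _))

  count-support : ∀ L p → 1 ≤ count L p → ∃ λ a → a ∈ L × label a ≡ p
  count-support []      p ()
  count-support (a ∷ L) p count≥1 with 1 ≤? δ (label a) p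
  ... | yes δ≥1 = a , here refl , δ-support (label a) p δ≥1
  ... | no  δ≱1 =
    let b , b∈L , lb≡p = count-support L p
          (subst (λ d → 1 ≤ d + count L p) (n<1⇒n≡0 (≰⇒> δ≱1)) count≥1)
    in b , there b∈L , lb≡p

  count-++ : ∀ L L' p → count (L ++ L') p ≡ count L p + count L' p
  count-++ []      L' p = refl
  count-++ (a ∷ L) L' p =
    trans (cong (δ (label a) p +_) (count-++ L L' p)) (sym (+-assoc (δ (label a) p) _ _))

  count-filter : ∀ {P : A → Set} (P? : Decidable P) L p →
    count L p ≡ count (filter P? L) p + count (filter (¬? ∘ P?) L) p
  count-filter P? []      p = refl
  count-filter P? (a ∷ L) p with P? a
  ... | yes _ = trans (cong (δ (label a) p +_) (count-filter P? L p))
                      (sym (+-assoc (δ (label a) p) _ _))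
  ... | no  _ = trans (cong (δ (label a) p +_) (count-filter P? L p))
                      (x∙yz≈y∙xz (δ (label a) p) (count (filter P? L) p)
                                 (count (filter (¬? ∘ P?) L) p))

  count-≤1 : ∀ {L} → Unique L → LabelInjective L → ∀ p → count L p ≤ 1
  count-≤1 {[]}    _             _   p = z≤n
  count-≤1 {a ∷ L} (a∉L ∷ uniqL) inj p with 1 ≤? count L p
  ... | no  count≱1 =
    subst (λ d → δ (label a) p + d ≤ 1) (sym (n<1⇒n≡0 (≰⇒> count≱1)))
      (subst (_≤ 1) (sym (+-identityʳ _)) (δ≤1 (label a) p))
  ... | yes count≥1 =
    let b , b∈L , lb≡p = count-support L p count≥1
        la≢p = λ la≡p → All.lookup a∉L b∈L (inj (here refl) (there b∈L) (trans la≡p (sym lb≡p)))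
    in subst (λ d → d + count L p ≤ 1) (sym (δ-off la≢p))
         (count-≤1 uniqL (λ a∈ b∈ → inj (there a∈) (there b∈)) p)

  count-≤ : ∀ (M : Fin n → ℕ) {L} → Unique L → LabelInjective L →
    All (λ a → 1 ≤ M (label a)) L → ∀ p → count L p ≤ M p
  count-≤ M {L} uniqL inj positive p with 1 ≤? count L p
  ... | no  count≱1 = ≤-trans (≤-pred (≰⇒> count≱1)) z≤n
  ... | yes count≥1 with count-support L p count≥1
  ...   | a , a∈L , refl = ≤-trans (count-≤1 uniqL inj p) (All.lookup positive a∈L)

module ProcessTheory (N : Net) where
  open Net N
  open LabelCount (lab {np})

  Cond : Set
  Cond = CondId np

  History : Set
  History = List (Ev N)

  _≺⟨_⟩_ : Cond → History → Cond → Set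
  c ≺⟨ es ⟩ d = _≺[_]_ N c es d

  indicator-true : ∀ {b} → b ≡ true → 1 ≤ indicator N b
  indicator-true refl = s≤s z≤n

  weight-+ : ∀ d a b → weight N d (a + b) ≡ weight N d a + weight N d b
  weight-+ zero    a b = refl
  weight-+ (suc d) a b = refl

  weight-mono : ∀ d {a b} → a ≤ b → weight N d a ≤ weight N d b
  weight-mono zero    _   = z≤n
  weight-mono (suc d) a≤b = a≤b

  weight-zero : ∀ d → weight N d 0 ≡ 0
  weight-zero zero    = refl
  weight-zero (suc d) = refl

  weight-one : ∀ d → 1 ≤ d → weight N d 1 ≡ 1
  weight-one (suc d) _ = refl

  ∑-weight-count : ∀ L → All (λ c → 1 ≤ τ (lab c)) L →
    ∑ (λ p → weight N (τ p) (count L p)) ≡ length L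
  ∑-weight-count []      []            = ∑-zero _ (weight-zero ∘ τ)
  ∑-weight-count (c ∷ L) (τc≥1 ∷ τL≥1) = begin
      ∑ (λ p → weight N (τ p) (δ (lab c) p + count L p))
    ≡⟨ sum-cong-≗ (λ p → weight-+ (τ p) (δ (lab c) p) (count L p)) ⟩
      ∑ (λ p → weight N (τ p) (δ (lab c) p) + weight N (τ p) (count L p))
    ≡⟨ ∑-distrib-+ (λ p → weight N (τ p) (δ (lab c) p)) _ ⟩
      ∑ (λ p → weight N (τ p) (δ (lab c) p)) + ∑ (λ p → weight N (τ p) (count L p))
    ≡⟨ cong₂ _+_ (∑-δ (weight N ∘ τ) (weight-zero ∘ τ) (lab c)) (∑-weight-count L τL≥1) ⟩
      weight N (τ (lab c)) 1 + length L
    ≡⟨ cong (_+ length L) (weight-one (τ (lab c)) τc≥1) ⟩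
      suc (length L)
    ∎
    where open ≡-Reasoning

  length≤conc : ∀ L M → All (λ c → 1 ≤ τ (lab c)) L → (∀ p → count L p ≤ M p) →
    length L ≤ conc N M
  length≤conc L M τL≥1 covered = begin
      length L
    ≡⟨ sym (∑-weight-count L τL≥1) ⟩
      ∑ (λ p → weight N (τ p) (count L p))
    ≤⟨ ∑-mono _ _ (λ p → weight-mono (τ p) (covered p)) ⟩
      ∑ (λ p → weight N (τ p) (M p))
    ≡⟨ sym (trans (cong sum (map-tabulate (λ p → p) (λ p → weight N (τ p) (M p))))
                  (sum-tabulate (λ p → weight N (τ p) (M p)))) ⟩
      conc N M
    ∎
    where open ≤-Reasoning

  evAt-∷ʳ : ∀ (es : History) x j e → evAt N es j ≡ just e → evAt N (es ∷ʳ x) j ≡ just e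
  evAt-∷ʳ (_ ∷ es) x zero    e found = found
  evAt-∷ʳ (_ ∷ es) x (suc j) e found = evAt-∷ʳ es x j e found

  evAt-last : ∀ (es : History) x → evAt N (es ∷ʳ x) (length es) ≡ just x
  evAt-last []       x = refl
  evAt-last (_ ∷ es) x = evAt-last es x

  evAt-∷ʳ⁻ : ∀ (es : History) x j e → evAt N (es ∷ʳ x) j ≡ just e →
    evAt N es j ≡ just e ⊎ (j ≡ length es × e ≡ x)
  evAt-∷ʳ⁻ []       x zero    e found = inj₂ (refl , sym (just-injective found))
  evAt-∷ʳ⁻ (_ ∷ es) x zero    e found = inj₁ found
  evAt-∷ʳ⁻ (_ ∷ es) x (suc j) e found with evAt-∷ʳ⁻ es x j e found
  ... | inj₁ old         = inj₁ old
  ... | inj₂ (j≡n , e≡x) = inj₂ (cong suc j≡n , e≡x)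

  prec-∷ʳ : ∀ es x {c d} → c ≺⟨ es ⟩ d → c ≺⟨ es ∷ʳ x ⟩ d
  prec-∷ʳ es x = go
    where
    step-∷ʳ : ∀ {c d} → Step N es c d → Step N (es ∷ʳ x) c d
    step-∷ʳ {d = out j p} (e , found , p∈e• , c∈) = e , evAt-∷ʳ es x j e found , p∈e• , c∈
    go : ∀ {c d} → c ≺⟨ es ⟩ d → c ≺⟨ es ∷ʳ x ⟩ d
    go [ s ]     = [ step-∷ʳ s ]
    go (s ∷ c≺d) = step-∷ʳ s ∷ go c≺d

  prec⇒consumed : ∀ es {c d} → c ≺⟨ es ⟩ d → Consumed N es c
  prec⇒consumed es [ s ]   = step⇒consumed s
    where
    step⇒consumed : ∀ {c d} → Step N es c d → Consumed N es c
    step⇒consumed {d = out j _} (e , found , _ , c∈) = j , e , found , c∈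
  prec⇒consumed es (s ∷ _) = prec⇒consumed es [ s ]

  Antichain : History → List Cond → Set
  Antichain es L = ∀ {c₁ c₂} → c₁ ∈ L → c₂ ∈ L → ¬ c₁ ≺⟨ es ⟩ c₂

  Covered : List Cond → Set
  Covered L = ∃ λ M → Reachable N M × (∀ p → count L p ≤ M p)

  covered-initial : ∀ {L} → Unique L → All (IsCond N []) L → Covered L
  covered-initial {L} uniqL condL =
    M-I N , init , count-≤ (M-I N) uniqL injective (All.map initial-in-I condL)
    where
    initial-in-I : ∀ {c} → IsCond N [] c → 1 ≤ M-I N (lab c)
    initial-in-I {ini p}   p∈I = indicator-true p∈I
    initial-in-I {out j p} (_ , () , _)
    initial : ∀ {c} → c ∈ L → ∃ λ p → c ≡ ini p
    initial c∈L with All.lookup condL c∈L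
    initial {ini p}   _ | _            = p , refl
    initial {out j p} _ | (_ , () , _)
    injective : LabelInjective L
    injective c₁∈L c₂∈L l≡ with initial c₁∈L | initial c₂∈L
    ... | _ , refl | _ , refl = cong ini l≡

  IsNew : ℕ → Cond → Set
  IsNew n (ini _)   = ⊥
  IsNew n (out j _) = j ≡ n

  isNew? : ∀ n → Decidable (IsNew n)
  isNew? n (ini _)   = no (λ ())
  isNew? n (out j _) = j ≟ n

  module Extension {es : History} (t : Fin nt) (P'' : List Cond)
      (condP : All (IsCond N es) P'') (maximalP : All (λ c → ¬ Consumed N es c) P'')
      (distinctP : Unique (map lab P'')) (preset : ∀ p → (pre t p ≡ true) ⇔ (p ∈ map lab P''))
      where

    n : ℕ
    n = length es

    es′ : History
    es′ = es ∷ʳ (t , P'')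

    old-cond : ∀ {c} → IsCond N es′ c → ¬ IsNew n c → IsCond N es c
    old-cond {ini p}   p∈I _ = p∈I
    old-cond {out j p} (e , found , p∈e•) notNew with evAt-∷ʳ⁻ es _ j e found
    ... | inj₁ old       = e , old , p∈e•
    ... | inj₂ (j≡n , _) = ⊥-elim (notNew j≡n)

    new-event : ∀ {e} → evAt N es′ n ≡ just e → e ≡ (t , P'')
    new-event found = just-injective (trans (sym found) (evAt-last es _))

    new-post : ∀ {c} → IsNew n c → IsCond N es′ c → post t (lab c) ≡ true
    new-post {out _ p} refl (e , found , p∈e•) =
      subst (λ e → post (proj₁ e) p ≡ true) (new-event found) p∈e•

    preset-step : ∀ {a c} → IsNew n a → IsCond N es′ a → c ∈ P'' → Step N es′ c a
    preset-step {out _ _} refl condA c∈P = _ , evAt-last es _ , new-post refl condA , c∈P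

    new-injective : ∀ {c₁ c₂} → IsNew n c₁ → IsNew n c₂ → lab c₁ ≡ lab c₂ → c₁ ≡ c₂
    new-injective {out _ _} {out _ _} refl refl l≡ = cong (out n) l≡

    pre≤count : ∀ p → indicator N (pre t p) ≤ count P'' p
    pre≤count p with pre t p in p∈•t
    ... | false = z≤n
    ... | true with ∈-map⁻ lab (Equivalence.to (preset p) p∈•t)
    ...   | c , c∈P , refl = count-∈ c∈P

    New : List Cond → List Cond
    New = filter (isNew? n)

    Old : List Cond → List Cond
    Old = filter (¬? ∘ isNew? n)

    -- the places present just before t fired, for a cut L of es′
    Before : List Cond → List Cond
    Before L = Old L ++ P''

    old-member : ∀ {L c} → c ∈ Old L → c ∈ L × ¬ IsNew n c
    old-member = ∈-filter⁻ (¬? ∘ isNew? n)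

    new-member : ∀ {L c} → c ∈ New L → c ∈ L × IsNew n c
    new-member = ∈-filter⁻ (isNew? n)

    count-New≤post : ∀ {L} → Unique L → All (IsCond N es′) L →
      ∀ p → count (New L) p ≤ indicator N (post t p)
    count-New≤post {L} uniqL condL =
      count-≤ (indicator N ∘ post t) (Unique.filter⁺ (isNew? n) uniqL) injective
        (All.tabulate λ c∈New → let c∈L , new = new-member c∈New in
           indicator-true (new-post new (All.lookup condL c∈L)))
      where
      injective : LabelInjective (New L)
      injective c₁∈ c₂∈ =
        new-injective (proj₂ (new-member {L} c₁∈)) (proj₂ (new-member {L} c₂∈))

    before-conds : ∀ {L} → All (IsCond N es′) L → All (IsCond N es) (Before L)
    before-conds condL = ++⁺
      (All.tabulate λ c∈Old → let c∈L , old = old-member c∈Old in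
         old-cond (All.lookup condL c∈L) old)
      condP

    -- If L contains an output place a₀ of t, then every preset place precedes
    -- a₀; hence the preset is disjoint from the old part of L, and Before L is
    -- again an antichain (preset places are unconsumed, so they precede nothing).
    module _ {L a₀} (condL : All (IsCond N es′) L) (antiL : Antichain es′ L)
             (a₀∈L : a₀ ∈ L) (a₀new : IsNew n a₀) where

      preset≺new : ∀ {c} → c ∈ P'' → Step N es′ c a₀
      preset≺new = preset-step a₀new (All.lookup condL a₀∈L)

      before-unique : Unique L → Unique (Before L)
      before-unique uniqL =
        Unique.++⁺ (Unique.filter⁺ (¬? ∘ isNew? n) uniqL) (Unique.map⁻ distinctP)
          λ (c∈Old , c∈P) → antiL (proj₁ (old-member c∈Old)) a₀∈L [ preset≺new c∈P ]

      before-antichain : Antichain es (Before L)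
      before-antichain c₁∈ c₂∈ c₁≺c₂ with ∈-++⁻ (Old L) c₁∈ | ∈-++⁻ (Old L) c₂∈
      ... | inj₂ c₁∈P   | _ = All.lookup maximalP c₁∈P (prec⇒consumed es c₁≺c₂)
      ... | inj₁ c₁∈Old | inj₁ c₂∈Old =
        antiL (proj₁ (old-member c₁∈Old)) (proj₁ (old-member c₂∈Old)) (prec-∷ʳ es _ c₁≺c₂)
      ... | inj₁ c₁∈Old | inj₂ c₂∈P =
        antiL (proj₁ (old-member c₁∈Old)) a₀∈L (prec-∷ʳ es _ c₁≺c₂ ⁺∷ʳ preset≺new c₂∈P)

    covered-fire : ∀ {L} → Unique L → All (IsCond N es′) L → Covered (Before L) → Covered L
    covered-fire {L} uniqL condL (M , reachM , coverM) = fire N M t , step t reachM enabled , cover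
      where
      old+pre≤M : ∀ p → count (Old L) p + indicator N (pre t p) ≤ M p
      old+pre≤M p = begin
          count (Old L) p + indicator N (pre t p)
        ≤⟨ +-monoʳ-≤ (count (Old L) p) (pre≤count p) ⟩
          count (Old L) p + count P'' p
        ≡⟨ sym (count-++ (Old L) P'' p) ⟩
          count (Before L) p
        ≤⟨ coverM p ⟩
          M p
        ∎
        where open ≤-Reasoning

      enabled : Enabled N M t
      enabled p p∈•t =
        ≤-trans (≤-trans (indicator-true p∈•t) (m≤n+m _ (count (Old L) p))) (old+pre≤M p)

      cover : ∀ p → count L p ≤ fire N M t p
      cover p = begin
          count L p
        ≡⟨ count-filter (isNew? n) L p ⟩
          count (New L) p + count (Old L) p
        ≤⟨ +-mono-≤ (count-New≤post uniqL condL p) (m+n≤o⇒m≤o∸n _ (old+pre≤M p)) ⟩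
          indicator N (post t p) + (M p ∸ indicator N (pre t p))
        ≡⟨ +-comm (indicator N (post t p)) _ ⟩
          fire N M t p
        ∎
        where open ≤-Reasoning

    covered-extend :
      (∀ {L} → Unique L → All (IsCond N es) L → Antichain es L → Covered L) →
      ∀ {L} → Unique L → All (IsCond N es′) L → Antichain es′ L → Covered L
    covered-extend coveredOld {L} uniqL condL antiL with any? (isNew? n) L
    ... | no noNew = coveredOld uniqL
      (All.zipWith (λ (cond , old) → old-cond cond old) (condL , ¬Any⇒All¬ L noNew))
      (λ c₁∈ c₂∈ → antiL c₁∈ c₂∈ ∘ prec-∷ʳ es _)
    ... | yes someNew =
      let a₀ , a₀∈L , a₀new = find someNew in
      covered-fire uniqL condL
        (coveredOld (before-unique condL antiL a₀∈L a₀new uniqL) (before-conds condL)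
                    (before-antichain condL antiL a₀∈L a₀new))

  antichain-covered : ∀ {es} → IsProcess N es →
    ∀ {L} → Unique L → All (IsCond N es) L → Antichain es L → Covered L
  antichain-covered start uniqL condL _ = covered-initial uniqL condL
  antichain-covered (extend π t P'' condP maximalP distinctP preset) =
    Extension.covered-extend t P'' condP maximalP distinctP preset (antichain-covered π)

  active-antichain : ∀ {es T f u L} → Schedule N es T f → All (IsCond N es) L →
    All (Active N f u) L → Antichain es L
  active-antichain (respects , _) condL activeL c₁∈L c₂∈L c₁≺c₂ =
    <⇒≱ (proj₂ (All.lookup activeL c₁∈L))
      (≤-trans (respects _ _ (All.lookup condL c₁∈L) (All.lookup condL c₂∈L) c₁≺c₂)
               (proj₁ (All.lookup activeL c₂∈L)))

  interval-nonempty : ∀ a u d → a ≤ u → u < a + d → 1 ≤ d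
  interval-nonempty a u zero    a≤u u<a = ⊥-elim (<⇒≱ (subst (u <_) (+-identityʳ a) u<a) a≤u)
  interval-nonempty a u (suc d) _   _   = s≤s z≤n

  resource-bound : ∀ {es T f c} → IsProcess N es → Schedule N es T f → IsCT N c →
    ResourceBound N es T f c
  resource-bound {f = f} π sched (_ , conc≤CT) u _ L uniqL condL activeL =
    let M , reachM , coverM = antichain-covered π uniqL condL (active-antichain sched condL activeL)
        positive = All.map (λ {c} (start≤u , u<end) → interval-nonempty (f c) u _ start≤u u<end) activeL
    in ≤-trans (length≤conc L M positive coverM) (conc≤CT M reachM)

lemma2 : (N : Net) → IsWorkflowNet N → OneSafe N →
    ∀ (c : ℕ) → IsCT N c →
    ∀ (Π : List (Ev N)) → IsRun N Π → ∀ (k : ℕ) → IsRT N Π k → k ≤ c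
lemma2 N _ _ c isCT Π (process , _) k (T , ((f , sched) , _) , _ , leastK) =
  leastK c (f , sched , ProcessTheory.resource-bound N process sched isCT)
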